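{- Let $d_0\subseteq d$ and $a\subseteq a^*$ be finite tuples from $N$. Then (1) $\mathrm{rk}(d_0/a)\le\mathrm{rk}(d/a)$; and (2) $\mathrm{rk}(d/a^*)\le\mathrm{rk}(d/a)$.
   Context: $T$ is a complete first-order theory in a countable language, $N$ a countable atomic model of $T$ that is not minimal. $d\in\mathrm{pcl}(a)$ means every $M\preceq N$ containing $a$ contains $d$. $S_{at}(a)$ is the set of complete types over $a$ realized in $N$. Rank $\mathrm{rk}(d/a)\in\mathbf{ON}\cup\{\infty\}$: $\mathrm{rk}(d/a)\ge0$ always; for $\alpha>0$, $\mathrm{rk}(d/a)\ge\alpha$ iff for every $r\in S_{at}(a)$ and $\beta<\alpha$ there are finite $a',b,c$ from $N$ with $\mathrm{tp}(a'/a)=r$, $\mathrm{rk}(d/aa'bc)\ge\beta$, $c\in\mathrm{pcl}(daa'b)\setminus\mathrm{pcl}(aa'b)$; $\mathrm{rk}=\alpha$ if $\ge\alpha$ and not $\ge\alpha+1$; $\mathrm{rk}=\infty$ (greater than all ordinals) if $\ge\alpha$ for all $\alpha$. -}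

module Defs where

open import Level using (0ℓ)
open import Data.Nat using (ℕ; suc; _+_)
open import Data.Fin using (Fin)
open import Data.Vec using (Vec; []; _∷_; _++_; lookup)
open import Data.Vec.Relation.Unary.All using (All)
open import Data.Vec.Membership.Propositional using (_∈_)
open import Data.Product using (Σ; _×_; _,_)
open import Data.Sum using (_⊎_)
open import Data.Unit using (⊤)
open import Data.Empty using (⊥)
open import Relation.Nullary using (¬_)
open import Relation.Binary.PropositionalEquality using (_≡_)
open import Function using (_⇔_)
open import Function.Definitions using (Injective; Surjective)
open import Induction.WellFounded using (WellFounded; Acc; acc)

record Language : Set₁ where
  field
    Func : ℕ → Set
    Rel  : ℕ → Set

Countable : Set → Set
Countable A = Σ (A → ℕ) (λ f → Injective _≡_ _≡_ f)

CountableLanguage : Language → Set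
CountableLanguage L =
  (∀ k → Countable (Language.Func L k)) × (∀ k → Countable (Language.Rel L k))

module Syntax (L : Language) where
  open Language L

  data Term (n : ℕ) : Set where
    var : Fin n → Term n
    app : ∀ {k} → Func k → Vec (Term n) k → Term n

  data Formula (n : ℕ) : Set where
    ⊥'  : Formula n
    ⊤'  : Formula n
    _≐_ : Term n → Term n → Formula n
    rel : ∀ {k} → Rel k → Vec (Term n) k → Formula n
    _∧'_ _∨'_ _⇒'_ : Formula n → Formula n → Formula n
    ∀' ∃' : Formula (suc n) → Formula n

record Structure (L : Language) : Set₁ where
  open Language L
  field
    Carrier : Set
    fun : ∀ {k} → Func k → Vec Carrier k → Carrier
    rl  : ∀ {k} → Rel k → Vec Carrier k → Set

module Semantics {L : Language} (N : Structure L) where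
  open Language L
  open Syntax L
  open Structure N renaming (Carrier to C)

  mutual
    evalT : ∀ {n} → Vec C n → Term n → C
    evalT v (var i) = lookup v i
    evalT v (app f ts) = fun f (evalTs v ts)

    evalTs : ∀ {n k} → Vec C n → Vec (Term n) k → Vec C k
    evalTs v [] = []
    evalTs v (t ∷ ts) = evalT v t ∷ evalTs v ts

  -- With P = everything this is satisfaction in N; for a
  -- substructure P it is satisfaction in the substructure with universe P.
  SatIn : (C → Set) → ∀ {n} → Formula n → Vec C n → Set
  SatIn P ⊥' v = ⊥
  SatIn P ⊤' v = ⊤
  SatIn P (s ≐ t) v = evalT v s ≡ evalT v t
  SatIn P (rel r ts) v = rl r (evalTs v ts)
  SatIn P (φ ∧' ψ) v = SatIn P φ v × SatIn P ψ v
  SatIn P (φ ∨' ψ) v = SatIn P φ v ⊎ SatIn P ψ v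
  SatIn P (φ ⇒' ψ) v = SatIn P φ v → SatIn P ψ v
  SatIn P (∀' φ) v = (x : C) → P x → SatIn P φ (x ∷ v)
  SatIn P (∃' φ) v = Σ C (λ x → P x × SatIn P φ (x ∷ v))

  Sat : ∀ {n} → Formula n → Vec C n → Set
  Sat = SatIn (λ _ → ⊤)

  IsElemSub : (C → Set) → Set
  IsElemSub P =
    (∀ {k} (f : Func k) (xs : Vec C k) → All P xs → P (fun f xs)) ×
    (∀ {n} (φ : Formula n) (v : Vec C n) → All P v → (SatIn P φ v ⇔ Sat φ v))

  CountableModel : Set
  CountableModel = Σ (ℕ → C) (λ e → Surjective _≡_ _≡_ e)

  -- N is atomic: the type of every finite tuple is isolated
  -- (as T = Th(N) is complete, T ⊢ φ → ψ iff N ⊨ ∀x̄(φ → ψ)).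
  Atomic : Set
  Atomic = ∀ {n} (v : Vec C n) → Σ (Formula n) λ φ → Sat φ v ×
             (∀ (ψ : Formula n) → Sat ψ v → ∀ (w : Vec C n) → Sat φ w → Sat ψ w)

  NotMinimal : Set₁
  NotMinimal = Σ (C → Set) λ P → IsElemSub P × Σ C (λ x → ¬ P x)

  InPcl : ∀ {k n} → Vec C k → Vec C n → Set₁
  InPcl d a = ∀ (P : C → Set) → IsElemSub P → All P a → All P d

  SameType : ∀ {k n} → Vec C k → Vec C k → Vec C n → Set
  SameType {k} {n} a' e a = ∀ (φ : Formula (k + n)) → Sat φ (a' ++ a) ⇔ Sat φ (e ++ a)

  _⊆ₜ_ : ∀ {k m} → Vec C k → Vec C m → Set
  d₀ ⊆ₜ d = ∀ x → x ∈ d₀ → x ∈ d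

  -- rk(d/a) ≥ α, for α in an arbitrary well-founded order (ordinals are
  -- represented by well-founded relations; clauses β < α as in the paper).
  -- Types r ∈ S_at(a) are represented by realisations e in N.
  module Rank {O : Set} (_<_ : O → O → Set) (wf : WellFounded _<_) where
    RkGeAcc : ∀ {k n} → Vec C k → Vec C n → (α : O) → Acc _<_ α → Set₁
    RkGeAcc {k} {n} d a α (acc rs) =
      ∀ {m} (e : Vec C m) (β : O) (β<α : β < α) →
        Σ (Vec C m) λ a' → Σ ℕ λ p → Σ (Vec C p) λ b → Σ ℕ λ q → Σ (Vec C q) λ c →
          SameType a' e a ×
          RkGeAcc d (a ++ a' ++ b ++ c) β (rs β<α) ×
          InPcl c (d ++ a ++ a' ++ b) ×
          ¬ InPcl c (a ++ a' ++ b)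

    RkGe : ∀ {k n} → Vec C k → Vec C n → O → Set₁
    RkGe d a α = RkGeAcc d a α (wf α)

-- Both inequalities are instances of one monotonicity principle, proved by
-- induction on α: if d ⊆ d′ and B ⊆ A then rk(d/A) ≥ α implies rk(d′/B) ≥ α.
-- Given a type over B realised by e, apply the hypothesis to the type of e over
-- A; its realisation a′ has the type of e over B as well.  Taking A b in place
-- of b keeps every element of A in the new base, so the induction hypothesis
-- applies to the bases B a′ A b c ⊆ A a′ b c, and both pcl conditions transfer
-- because pcl is monotone in its base.
module Submission where

open import Defs
open import Level using (0ℓ)
open import Data.Nat using (zero; suc; _+_)
open import Data.Fin using (Fin; zero; suc)
open import Data.Vec using (Vec; []; _∷_; _++_; lookup)
open import Data.Vec.Relation.Unary.All as All using (All)
open import Data.Vec.Relation.Unary.All.Properties using (lookup⁻)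
open import Data.Vec.Relation.Unary.Any as Any using ()
open import Data.Vec.Membership.Propositional.Properties using (∈-lookup; ∈-++⁺ˡ; ∈-++⁺ʳ)
open import Data.Vec.Relation.Unary.Any.Properties as AnyP using (lookup-index)
open import Data.Product using (_×_; _,_)
open import Data.Product.Function.NonDependent.Propositional using (_×-⇔_)
open import Data.Sum using ([_,_]′)
open import Data.Sum.Function.Propositional using (_⊎-⇔_)
open import Relation.Binary.PropositionalEquality using (_≡_; refl; sym; cong; cong₂; _≗_)
open import Function using (_∘_; _⇔_; mk⇔; Equivalence)
open import Function.Construct.Identity using (⇔-id)
open import Function.Construct.Symmetry using (⇔-sym)
open import Function.Construct.Composition using (_⇔-∘_)
open import Function.Related.TypeIsomorphisms using (→-cong-⇔)
open import Induction.WellFounded using (WellFounded; Acc; acc)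
open import Axiom.ExcludedMiddle using (ExcludedMiddle)

module FormulaRenaming (L : Language) where
  open Language L
  open Syntax L

  mutual
    renT : ∀ {n n′} → (Fin n → Fin n′) → Term n → Term n′
    renT ρ (var i) = var (ρ i)
    renT ρ (app f ts) = app f (renTs ρ ts)

    renTs : ∀ {n n′ k} → (Fin n → Fin n′) → Vec (Term n) k → Vec (Term n′) k
    renTs ρ [] = []
    renTs ρ (t ∷ ts) = renT ρ t ∷ renTs ρ ts

  ext : ∀ {n n′} → (Fin n → Fin n′) → Fin (suc n) → Fin (suc n′)
  ext ρ zero = zero
  ext ρ (suc i) = suc (ρ i)

  extⁿ : ∀ m {n n′} → (Fin n → Fin n′) → Fin (m + n) → Fin (m + n′)
  extⁿ zero ρ = ρ
  extⁿ (suc m) ρ = ext (extⁿ m ρ)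

  ren : ∀ {n n′} → (Fin n → Fin n′) → Formula n → Formula n′
  ren ρ ⊥' = ⊥'
  ren ρ ⊤' = ⊤'
  ren ρ (s ≐ t) = renT ρ s ≐ renT ρ t
  ren ρ (rel r ts) = rel r (renTs ρ ts)
  ren ρ (φ ∧' ψ) = ren ρ φ ∧' ren ρ ψ
  ren ρ (φ ∨' ψ) = ren ρ φ ∨' ren ρ ψ
  ren ρ (φ ⇒' ψ) = ren ρ φ ⇒' ren ρ ψ
  ren ρ (∀' φ) = ∀' (ren (ext ρ) φ)
  ren ρ (∃' φ) = ∃' (ren (ext ρ) φ)

module _ {L : Language} (N : Structure L) where
  open Language L
  open Syntax L
  open Structure N renaming (Carrier to C)
  open Semantics N
  open FormulaRenaming L

  lookup-ext : ∀ {n n′} {ρ : Fin n → Fin n′} {v w} (x : C) →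
               lookup v ∘ ρ ≗ lookup w → lookup (x ∷ v) ∘ ext ρ ≗ lookup (x ∷ w)
  lookup-ext x v∘ρ≗w zero = refl
  lookup-ext x v∘ρ≗w (suc i) = v∘ρ≗w i

  lookup-extⁿ : ∀ {m n n′} {ρ : Fin n → Fin n′} {v w} (x : Vec C m) →
                lookup v ∘ ρ ≗ lookup w → lookup (x ++ v) ∘ extⁿ m ρ ≗ lookup (x ++ w)
  lookup-extⁿ [] v∘ρ≗w = v∘ρ≗w
  lookup-extⁿ (y ∷ x) v∘ρ≗w = lookup-ext y (lookup-extⁿ x v∘ρ≗w)

  mutual
    evalT-ren : ∀ {n n′} {ρ : Fin n → Fin n′} {v w} → lookup v ∘ ρ ≗ lookup w →
                ∀ t → evalT v (renT ρ t) ≡ evalT w t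
    evalT-ren v∘ρ≗w (var i) = v∘ρ≗w i
    evalT-ren v∘ρ≗w (app f ts) = cong (fun f) (evalTs-ren v∘ρ≗w ts)

    evalTs-ren : ∀ {n n′ k} {ρ : Fin n → Fin n′} {v w} → lookup v ∘ ρ ≗ lookup w →
                 (ts : Vec (Term n) k) → evalTs v (renTs ρ ts) ≡ evalTs w ts
    evalTs-ren v∘ρ≗w [] = refl
    evalTs-ren v∘ρ≗w (t ∷ ts) = cong₂ _∷_ (evalT-ren v∘ρ≗w t) (evalTs-ren v∘ρ≗w ts)

  satIn-ren : ∀ (P : C → Set) {n n′} {ρ : Fin n → Fin n′} {v w} → lookup v ∘ ρ ≗ lookup w →
              ∀ φ → SatIn P (ren ρ φ) v ⇔ SatIn P φ w
  satIn-ren P v∘ρ≗w ⊥' = ⇔-id _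
  satIn-ren P v∘ρ≗w ⊤' = ⇔-id _
  satIn-ren P {ρ = ρ} {v} {w} v∘ρ≗w (s ≐ t)
    rewrite evalT-ren {ρ = ρ} {v} {w} v∘ρ≗w s | evalT-ren {ρ = ρ} {v} {w} v∘ρ≗w t = ⇔-id _
  satIn-ren P {ρ = ρ} {v} {w} v∘ρ≗w (rel r ts)
    rewrite evalTs-ren {ρ = ρ} {v} {w} v∘ρ≗w ts = ⇔-id _
  satIn-ren P v∘ρ≗w (φ ∧' ψ) = satIn-ren P v∘ρ≗w φ ×-⇔ satIn-ren P v∘ρ≗w ψ
  satIn-ren P v∘ρ≗w (φ ∨' ψ) = satIn-ren P v∘ρ≗w φ ⊎-⇔ satIn-ren P v∘ρ≗w ψ
  satIn-ren P v∘ρ≗w (φ ⇒' ψ) = →-cong-⇔ (satIn-ren P v∘ρ≗w φ) (satIn-ren P v∘ρ≗w ψ)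
  satIn-ren P v∘ρ≗w (∀' φ) =
    mk⇔ (λ h x px → Equivalence.to (body x) (h x px))
        (λ h x px → Equivalence.from (body x) (h x px))
    where body = λ x → satIn-ren P (lookup-ext x v∘ρ≗w) φ
  satIn-ren P v∘ρ≗w (∃' φ) =
    mk⇔ (λ (x , px , h) → x , px , Equivalence.to (body x) h)
        (λ (x , px , h) → x , px , Equivalence.from (body x) h)
    where body = λ x → satIn-ren P (lookup-ext x v∘ρ≗w) φ

  ⊆ₜ-refl : ∀ {n} {xs : Vec C n} → xs ⊆ₜ xs
  ⊆ₜ-refl x x∈xs = x∈xs

  ⊆ₜ-trans : ∀ {m n o} {xs : Vec C m} {ys : Vec C n} {zs : Vec C o} →
             xs ⊆ₜ ys → ys ⊆ₜ zs → xs ⊆ₜ zs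
  ⊆ₜ-trans xs⊆ys ys⊆zs x = ys⊆zs x ∘ xs⊆ys x

  xs⊆ₜxs++ys : ∀ {m n} (xs : Vec C m) {ys : Vec C n} → xs ⊆ₜ (xs ++ ys)
  xs⊆ₜxs++ys xs x = ∈-++⁺ˡ

  ys⊆ₜxs++ys : ∀ {m n} (xs : Vec C m) {ys : Vec C n} → ys ⊆ₜ (xs ++ ys)
  ys⊆ₜxs++ys xs x = ∈-++⁺ʳ xs

  ++-⊆ₜ : ∀ {m n o} (xs : Vec C m) {ys : Vec C n} {zs : Vec C o} →
          xs ⊆ₜ zs → ys ⊆ₜ zs → (xs ++ ys) ⊆ₜ zs
  ++-⊆ₜ xs xs⊆zs ys⊆zs x = [ xs⊆zs x , ys⊆zs x ]′ ∘ AnyP.++⁻ xs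

  ++⁺-⊆ₜ : ∀ {m n m′ n′} (xs : Vec C m) {ys : Vec C n} (xs′ : Vec C m′) {ys′ : Vec C n′} →
           xs ⊆ₜ xs′ → ys ⊆ₜ ys′ → (xs ++ ys) ⊆ₜ (xs′ ++ ys′)
  ++⁺-⊆ₜ xs xs′ xs⊆xs′ ys⊆ys′ =
    ++-⊆ₜ xs (⊆ₜ-trans xs⊆xs′ (xs⊆ₜxs++ys xs′)) (⊆ₜ-trans ys⊆ys′ (ys⊆ₜxs++ys xs′))

  ++-assoc-⊆ₜ : ∀ {m n o} (xs : Vec C m) (ys : Vec C n) {zs : Vec C o} →
                ((xs ++ ys) ++ zs) ⊆ₜ (xs ++ ys ++ zs)
  ++-assoc-⊆ₜ xs ys =
    ++-⊆ₜ (xs ++ ys) (++⁺-⊆ₜ xs xs ⊆ₜ-refl (xs⊆ₜxs++ys ys))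
      (⊆ₜ-trans (ys⊆ₜxs++ys ys) (ys⊆ₜxs++ys xs))

  ++-absorb-⊆ₜ : ∀ {m n o p} {B : Vec C m} (a′ : Vec C n) (A : Vec C o) {t : Vec C p} →
                 B ⊆ₜ A → (B ++ a′ ++ A ++ t) ⊆ₜ (A ++ a′ ++ t)
  ++-absorb-⊆ₜ {B = B} a′ A B⊆A =
    ++-⊆ₜ B (⊆ₜ-trans B⊆A (xs⊆ₜxs++ys A))
      (++-⊆ₜ a′ (⊆ₜ-trans (xs⊆ₜxs++ys a′) (ys⊆ₜxs++ys A))
        (++-⊆ₜ A (xs⊆ₜxs++ys A) (⊆ₜ-trans (ys⊆ₜxs++ys a′) (ys⊆ₜxs++ys A))))

  ++-insert-⊆ₜ : ∀ {m n o p} (B : Vec C m) (a′ : Vec C n) (A : Vec C o) {t : Vec C p} →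
                 (A ++ a′ ++ t) ⊆ₜ (B ++ a′ ++ A ++ t)
  ++-insert-⊆ₜ B a′ A =
    ++-⊆ₜ A (⊆ₜ-trans (xs⊆ₜxs++ys A) (⊆ₜ-trans (ys⊆ₜxs++ys a′) (ys⊆ₜxs++ys B)))
      (⊆ₜ-trans (++⁺-⊆ₜ a′ a′ ⊆ₜ-refl (ys⊆ₜxs++ys A)) (ys⊆ₜxs++ys B))

  All-⊆ₜ : ∀ {m n} {P : C → Set} {xs : Vec C m} {ys : Vec C n} →
           xs ⊆ₜ ys → All P ys → All P xs
  All-⊆ₜ {xs = xs} xs⊆ys pys = lookup⁻ (λ i → All.lookup pys (xs⊆ys _ (∈-lookup i xs)))

  inPcl-mono : ∀ {k m n} {c : Vec C k} {xs : Vec C m} {ys : Vec C n} →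
               xs ⊆ₜ ys → InPcl c xs → InPcl c ys
  inPcl-mono xs⊆ys c∈pcl P elem pys = c∈pcl P elem (All-⊆ₜ xs⊆ys pys)

  ⊆ₜ-index : ∀ {m n} {xs : Vec C m} {ys : Vec C n} → xs ⊆ₜ ys → Fin m → Fin n
  ⊆ₜ-index {xs = xs} xs⊆ys i = Any.index (xs⊆ys _ (∈-lookup i xs))

  lookup-⊆ₜ-index : ∀ {m n} {xs : Vec C m} {ys : Vec C n} (xs⊆ys : xs ⊆ₜ ys) →
                    lookup ys ∘ ⊆ₜ-index xs⊆ys ≗ lookup xs
  lookup-⊆ₜ-index {xs = xs} xs⊆ys i = sym (lookup-index (xs⊆ys _ (∈-lookup i xs)))

  sameType-⊆ₜ : ∀ {m n n′} {a′ e : Vec C m} {A : Vec C n} {B : Vec C n′} →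
                B ⊆ₜ A → SameType a′ e A → SameType a′ e B
  sameType-⊆ₜ {m} {a′ = a′} {e} B⊆A a′≡e φ =
    over e ⇔-∘ (a′≡e (ren (extⁿ m (⊆ₜ-index B⊆A)) φ) ⇔-∘ ⇔-sym (over a′))
    where over = λ x → satIn-ren _ (lookup-extⁿ x (lookup-⊆ₜ-index B⊆A)) φ

  module _ {O : Set} (_<_ : O → O → Set) (wf : WellFounded _<_) where
    open Rank _<_ wf

    rkGeAcc-mono : ∀ {k k′ n n′} {d : Vec C k} {d′ : Vec C k′} {A : Vec C n} {B : Vec C n′} →
                   d ⊆ₜ d′ → B ⊆ₜ A →
                   ∀ {α} (acc-α : Acc _<_ α) → RkGeAcc d A α acc-α → RkGeAcc d′ B α acc-α
    rkGeAcc-mono {d = d} {d′} {A} {B} d⊆d′ B⊆A (acc rs) rk e β β<α with rk e β β<α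
    ... | a′ , _ , b , _ , c , a′≡e , rk′ , c∈pcl , c∉pcl =
      a′ , _ , A ++ b , _ , c , sameType-⊆ₜ B⊆A a′≡e ,
      rkGeAcc-mono d⊆d′ new⊆old (rs β<α) rk′ ,
      inPcl-mono (++⁺-⊆ₜ d d′ d⊆d′ (++-insert-⊆ₜ B a′ A)) c∈pcl ,
      c∉pcl ∘ inPcl-mono (++-absorb-⊆ₜ a′ A B⊆A)
      where
      new⊆old : (B ++ a′ ++ (A ++ b) ++ c) ⊆ₜ (A ++ a′ ++ b ++ c)
      new⊆old = ⊆ₜ-trans (++⁺-⊆ₜ B B ⊆ₜ-refl (++⁺-⊆ₜ a′ a′ ⊆ₜ-refl (++-assoc-⊆ₜ A b)))
                         (++-absorb-⊆ₜ a′ A B⊆A)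

lemma3p1 : ExcludedMiddle 0ℓ →
    (L : Language) → CountableLanguage L →
    (N : Structure L) →
    Semantics.CountableModel N → Semantics.Atomic N → Semantics.NotMinimal N →
    ∀ {k₀ k n n*} (d₀ : Vec (Structure.Carrier N) k₀) (d : Vec (Structure.Carrier N) k)
      (a : Vec (Structure.Carrier N) n) (a* : Vec (Structure.Carrier N) n*) →
    Semantics._⊆ₜ_ N d₀ d → Semantics._⊆ₜ_ N a a* →
    (O : Set) (_<_ : O → O → Set) (wf : WellFounded _<_) →
    (∀ α → Semantics.Rank.RkGe N _<_ wf d₀ a α → Semantics.Rank.RkGe N _<_ wf d a α) ×
    (∀ α → Semantics.Rank.RkGe N _<_ wf d a* α → Semantics.Rank.RkGe N _<_ wf d a α)
lemma3p1 _ _ _ N _ _ _ _ _ _ _ d₀⊆d a⊆a* _ _<_ wf =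
  (λ α → rkGeAcc-mono N _<_ wf d₀⊆d (⊆ₜ-refl N) (wf α)) ,
  (λ α → rkGeAcc-mono N _<_ wf (⊆ₜ-refl N) a⊆a* (wf α))
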